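{- Let $G$ be a connected oriented graph derived from a Burling tree $(T,r,\ell,c)$, and suppose $G$ has no cut vertex and no vertex of degree at most $1$. Let $S$ be the top-set of $G$. Then: (i) $G[S]$ is an in-star with at least two leaves (so $G$ has a unique pivot and its in-neighbours in $G[S]$ are the antennas of $G$); (ii) all vertices of $S\setminus\{v\}$ are sources of $G$, where $v$ is the unique sink of $G[S]$; (iii) the pivot of $G$ is an ancestor in $T$ of all vertices of $V(G)\setminus S$.
   Context: Rooted trees: for a rooted tree $(T,r)$ and $v\neq r$, $p(v)$ is the parent of $v$. A branch is a path $v_1v_2\dots v_k$ of $T$ with $v_i$ the parent of $v_{i+1}$ for all $i$ (it starts at $v_1$); a branch may be empty. Ancestors of $v$ are the vertices of the path from $v$ to the root (including $v$). A Burling tree is a 4-tuple $(T,r,\ell,c)$ where $T$ is a rooted tree with root $r$; $\ell$ assigns to every non-leaf vertex $v$ one of its children $\ell(v)$, the last-born of $v$; and $c$ is a function on $V(T)$ such that if $v\neq r$ is not a last-born then $c(v)$ is the vertex set of a (possibly empty) branch of $T$ starting at $\ell(p(v))$, while $c(v)=\varnothing$ if $v$ is the root or a last-born. The oriented graph fully derived from the Burling tree has vertex set $V(T)$ and an arc $uv$ iff $v\in c(u)$. An oriented graph $G$ is derived from the Burling tree if it is an induced subgraph of the fully derived oriented graph. The top-set of $G$ is the set of vertices $v$ of $G$ such that $v$ is the only vertex of $G$ on the path of $T$ from $r$ to $v$. A pivot of $G$ is a sink of $G[S]$ and an antenna of $G$ is a source of $G[S]$, where $S$ is the top-set. An in-tree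 is an oriented graph obtained from a rooted tree by orienting every edge towards the root; a leaf of an in-tree is a source with exactly one out-neighbour; an in-star is an in-tree whose unique sink is adjacent to all other vertices. Degree, connectivity and cut vertices refer to the underlying graph. -}

module Defs where

open import Data.Nat using (ℕ; zero; suc; _≤_)
open import Data.Fin using (Fin)
open import Data.Bool using (Bool; true; false; _∧_; _∨_)
open import Data.List using (List; length; filterᵇ; allFin)
open import Data.Product using (Σ; ∃; _×_; _,_)
open import Data.Sum using (_⊎_)
open import Relation.Nullary using (¬_)
open import Relation.Binary.PropositionalEquality using (_≡_; _≢_)
open import Function.Bundles using (_⇔_)

iter : ∀ {n} → (Fin n → Fin n) → ℕ → Fin n → Fin n
iter p zero    v = v
iter p (suc k) v = p (iter p k v)

-- Anc p u v : u is an ancestor of v (u lies on the path from v to the root;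
-- includes u ≡ v).  Uses the convention p r ≡ r.
Anc : ∀ {n} → (Fin n → Fin n) → Fin n → Fin n → Set
Anc p u v = ∃ λ k → iter p k v ≡ u

-- B (as a characteristic function) is the vertex set of a (possibly empty)
-- branch of T starting at a: either empty, or the vertices of the path
-- a = v1, v2, ..., vk = e going down from a to some descendant e of a.
IsBranchSet : ∀ {n} → (Fin n → Fin n) → Fin n → (Fin n → Bool) → Set
IsBranchSet p a B =
  (∀ w → B w ≡ false)
  ⊎ (∃ λ e → Anc p a e × (∀ w → (B w ≡ true) ⇔ (Anc p a w × Anc p w e)))

-- The rooted tree is given by a root r, a parent map p (with p r ≡ r as a
-- convention) and a depth function certifying that iterating p from any
-- vertex reaches r (so the edges {v , p v}, v ≢ r, form a tree rooted at r).
record BurlingTree (n : ℕ) : Set where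
  field
    r     : Fin n
    p     : Fin n → Fin n
    depth : Fin n → ℕ
    p-root       : p r ≡ r
    depth-root   : depth r ≡ 0
    depth-parent : ∀ v → v ≢ r → depth v ≡ suc (depth (p v))
    ℓ     : Fin n → Fin n
    ℓ-child : ∀ v → (∃ λ u → u ≢ r × p u ≡ v) → (ℓ v ≢ r × p (ℓ v) ≡ v)
    c     : Fin n → Fin n → Bool
    c-root     : ∀ w → c r w ≡ false
    c-lastborn : ∀ v → (∃ λ u → (∃ λ x → x ≢ r × p x ≡ u) × ℓ u ≡ v)
                 → ∀ w → c v w ≡ false
    c-branch   : ∀ v → v ≢ r → ¬ (∃ λ u → (∃ λ x → x ≢ r × p x ≡ u) × ℓ u ≡ v)
                 → IsBranchSet p (ℓ (p v)) (c v)

module _ {n : ℕ} (B : BurlingTree n) (X : Fin n → Bool) where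
  open BurlingTree B

  -- G is the subgraph of the fully derived graph induced by {v | X v ≡ true}
  InG : Fin n → Set
  InG v = X v ≡ true

  Arc : Fin n → Fin n → Set
  Arc u v = InG u × InG v × c u v ≡ true

  Adj : Fin n → Fin n → Set
  Adj u v = Arc u v ⊎ Arc v u

  adjᵇ : Fin n → Fin n → Bool
  adjᵇ u v = X u ∧ X v ∧ (c u v ∨ c v u)

  degree : Fin n → ℕ
  degree v = length (filterᵇ (λ u → adjᵇ u v) (allFin n))

  data Walk (P : Fin n → Set) : Fin n → Fin n → Set where
    here : ∀ {u} → P u → Walk P u u
    step : ∀ {u w v} → P u → Adj u w → Walk P w v → Walk P u v

  Connected : Set
  Connected = (∃ λ v → InG v) × (∀ u v → InG u → InG v → Walk InG u v)

  NoCutVertex : Set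
  NoCutVertex = ∀ x → InG x → ∀ u v →
    (InG u × u ≢ x) → (InG v × v ≢ x) → Walk (λ w → InG w × w ≢ x) u v

  NoVertexOfDegreeAtMost1 : Set
  NoVertexOfDegreeAtMost1 = ∀ v → InG v → 2 ≤ degree v

  Top : Fin n → Set
  Top v = InG v × (∀ w → InG w → Anc p w v → w ≡ v)

  ArcS : Fin n → Fin n → Set
  ArcS u v = Top u × Top v × Arc u v

  -- G[S] is an in-star with sink s: an in-tree whose unique sink s is
  -- adjacent to all other vertices, i.e. the arcs of G[S] are exactly u s
  -- for u ∈ S, u ≢ s.
  InStarWithSink : Fin n → Set
  InStarWithSink s = Top s × (∀ u v → Top u → Top v → ArcS u v ⇔ (u ≢ s × v ≡ s))

  LeafS : Fin n → Set
  LeafS u = Top u × (∀ w → ¬ ArcS w u)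
          × (∃ λ w → ArcS u w × (∀ w' → ArcS u w' → w' ≡ w))

  IsSourceOfG : Fin n → Set
  IsSourceOfG u = ∀ w → ¬ Arc w u

{-# OPTIONS --safe #-}
-- An arc u → v of a Burling graph ends on the branch starting at ℓ(p u), so it never decreases
-- depth, never enters the subtree of u, and ends at a last-born when it keeps depth; moreover a
-- vertex sends at most one arc into S.  Every vertex of G lies below a unique vertex of S.  If
-- t → s is an arc of G[S], then t has no in-neighbour and no proper descendant in G, because the
-- no-cut-vertex condition would otherwise produce a directed cycle through t in G[S].  So G[S]
-- has a sink s, and propagating along walks from s shows that every other vertex of S sends its
-- arc to s and everything else of G lies below s; the two leaves are neighbours of s supplied by
-- the degree condition.
module Submission where

open import Defs
open import Data.Nat using (ℕ; zero; suc; _+_; _≤_; s≤s)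
open import Data.Nat.Properties
  using ( ≤-refl; ≤-trans; ≤-antisym; ≤-reflexive; ≤-total; n≤1+n; n<1+n; n≮n; +-comm; suc-injective
        ; m≤n⇒∃[o]m+o≡n; module ≤-Reasoning)
open import Data.Fin using (Fin) renaming (_≟_ to _≟ᶠ_)
open import Data.Fin.Properties using (any?)
open import Data.Bool using (Bool; true; false; T?)
open import Data.Bool.Properties using (T-≡) renaming (_≟_ to _≟ᵇ_)
open import Data.List using (List; []; _∷_; length; filterᵇ; allFin)
open import Data.List.Membership.Propositional using (_∈_)
open import Data.List.Membership.Propositional.Properties using (∈-filter⁻)
open import Data.List.Relation.Unary.Any using (here; there)
open import Data.List.Relation.Unary.All using (_∷_)
open import Data.List.Relation.Unary.AllPairs using (_∷_)
open import Data.List.Relation.Unary.Unique.Propositional using (Unique)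
open import Data.List.Relation.Unary.Unique.Propositional.Properties using (allFin⁺; filter⁺)
open import Data.Product using (∃; ∃₂; _×_; _,_; proj₁; proj₂)
open import Data.Sum using (_⊎_; inj₁; inj₂; [_,_]′)
open import Data.Empty using (⊥-elim)
open import Function using (id; _∘_)
open import Function.Bundles using (_⇔_; mk⇔; Equivalence)
open import Relation.Nullary using (¬_; Dec; yes; no; contradiction)
open import Relation.Nullary.Decidable using (_×-dec_)
open import Relation.Binary.PropositionalEquality
  using (_≡_; _≢_; refl; sym; trans; cong; subst; module ≡-Reasoning)

module Ancestry {n : ℕ} (p : Fin n → Fin n) where

  iter-+ : ∀ k j v → iter p (k + j) v ≡ iter p k (iter p j v)
  iter-+ zero    j v = refl
  iter-+ (suc k) j v = cong p (iter-+ k j v)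

  iter-suc : ∀ k v → iter p (suc k) v ≡ iter p k (p v)
  iter-suc zero    v = refl
  iter-suc (suc k) v = cong p (iter-suc k v)

  anc-refl : ∀ v → Anc p v v
  anc-refl v = 0 , refl

  anc-parent : ∀ v → Anc p (p v) v
  anc-parent v = 1 , refl

  anc-trans : ∀ {a b c} → Anc p a b → Anc p b c → Anc p a c
  anc-trans {c = c} (k , refl) (j , refl) = k + j , iter-+ k j c

  anc-cases : ∀ {a b} → Anc p a b → a ≡ b ⊎ Anc p a (p b)
  anc-cases (zero , refl)          = inj₁ refl
  anc-cases {b = b} (suc k , refl) = inj₂ (k , sym (iter-suc k b))

  anc-strict : ∀ {a b} → Anc p a b → a ≢ b → Anc p a (p b)
  anc-strict a↑b a≢b with anc-cases a↑b
  ... | inj₁ a≡b  = contradiction a≡b a≢b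
  ... | inj₂ a↑pb = a↑pb

  iter-anc : ∀ i d v → Anc p (iter p (i + d) v) (iter p i v)
  iter-anc i d v = d , trans (sym (iter-+ d i v)) (cong (λ m → iter p m v) (+-comm d i))

  anc-comparable : ∀ {a b v} → Anc p a v → Anc p b v → Anc p a b ⊎ Anc p b a
  anc-comparable {v = v} (i , refl) (j , refl) with ≤-total i j
  ... | inj₁ i≤j with d , refl ← m≤n⇒∃[o]m+o≡n i≤j = inj₂ (iter-anc i d v)
  ... | inj₂ j≤i with d , refl ← m≤n⇒∃[o]m+o≡n j≤i = inj₁ (iter-anc j d v)

module RootedTree {n : ℕ} (B : BurlingTree n) where
  open BurlingTree B
  open Ancestry p

  iter-root : ∀ k → iter p k r ≡ r
  iter-root zero    = refl
  iter-root (suc k) = trans (cong p (iter-root k)) p-root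

  anc-root : ∀ {w} → Anc p w r → w ≡ r
  anc-root (k , refl) = iter-root k

  depth-parent-≤ : ∀ v → depth (p v) ≤ depth v
  depth-parent-≤ v with v ≟ᶠ r
  ... | yes refl = ≤-reflexive (cong depth p-root)
  ... | no v≢r   = ≤-trans (n≤1+n _) (≤-reflexive (sym (depth-parent v v≢r)))

  anc⇒depth-≤ : ∀ {a b} → Anc p a b → depth a ≤ depth b
  anc⇒depth-≤ (zero  , refl)         = ≤-refl
  anc⇒depth-≤ {b = b} (suc k , refl) = ≤-trans (depth-parent-≤ (iter p k b)) (anc⇒depth-≤ (k , refl))

  anc-depth-≡⇒≡ : ∀ {a b} → Anc p a b → depth a ≡ depth b → a ≡ b
  anc-depth-≡⇒≡ {a} {b} a↑b da≡db with a ≟ᶠ b | b ≟ᶠ r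
  ... | yes a≡b | _        = a≡b
  ... | no _    | yes refl = anc-root a↑b
  ... | no a≢b  | no b≢r   = contradiction b<b (n≮n (depth b))
    where
    b<b : suc (depth b) ≤ depth b
    b<b = ≤-trans (s≤s (≤-trans (≤-reflexive (sym da≡db)) (anc⇒depth-≤ (anc-strict a↑b a≢b))))
                  (≤-reflexive (sym (depth-parent b b≢r)))

module BurlingArcs {n : ℕ} (B : BurlingTree n) where
  open BurlingTree B
  open Ancestry p
  open RootedTree B

  LastBorn : Fin n → Set
  LastBorn v = ∃ λ u → (∃ λ x → x ≢ r × p x ≡ u) × ℓ u ≡ v

  last-born-no-out-arc : ∀ {v w} → LastBorn v → c v w ≢ true
  last-born-no-out-arc {v} {w} lb vw = contradiction (trans (sym vw) (c-lastborn v lb w)) λ ()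

  ℓ-parent : ∀ {u} → u ≢ r → ℓ (p u) ≢ r × p (ℓ (p u)) ≡ p u
  ℓ-parent {u} u≢r = ℓ-child (p u) (u , u≢r , refl)

  depth-ℓ-parent : ∀ {u} → u ≢ r → depth (ℓ (p u)) ≡ depth u
  depth-ℓ-parent {u} u≢r = begin
    depth (ℓ (p u))           ≡⟨ depth-parent _ (proj₁ (ℓ-parent u≢r)) ⟩
    suc (depth (p (ℓ (p u)))) ≡⟨ cong (suc ∘ depth) (proj₂ (ℓ-parent u≢r)) ⟩
    suc (depth (p u))         ≡⟨ sym (depth-parent u u≢r) ⟩
    depth u                   ∎
    where open ≡-Reasoning

  module FullArc {u v : Fin n} (uv : c u v ≡ true) where

    source≢root : u ≢ r
    source≢root u≡r = contradiction (trans (sym uv) (trans (cong (λ x → c x v) u≡r) (c-root v))) λ ()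

    source-not-last-born : ¬ LastBorn u
    source-not-last-born lb = last-born-no-out-arc lb uv

    branch : ∃ λ e → Anc p (ℓ (p u)) e × (∀ w → (c u w ≡ true) ⇔ (Anc p (ℓ (p u)) w × Anc p w e))
    branch with c-branch u source≢root source-not-last-born
    ... | inj₁ empty = contradiction (trans (sym uv) (empty v)) λ ()
    ... | inj₂ nonempty = nonempty

    target-below-ℓ : Anc p (ℓ (p u)) v
    target-below-ℓ = proj₁ (Equivalence.to (proj₂ (proj₂ branch) v) uv)

    between : ∀ {t} → Anc p (ℓ (p u)) t → Anc p t v → c u t ≡ true
    between {t} ℓ↑t t↑v with branch
    ... | _ , _ , mem = Equivalence.from (mem t) (ℓ↑t , anc-trans t↑v (proj₂ (Equivalence.to (mem v) uv)))

    targets-comparable : ∀ {w} → c u w ≡ true → Anc p v w ⊎ Anc p w v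
    targets-comparable {w} uw with branch
    ... | _ , _ , mem = anc-comparable (proj₂ (Equivalence.to (mem v) uv)) (proj₂ (Equivalence.to (mem w) uw))

    target-below-parent : Anc p (p u) v
    target-below-parent = anc-trans (1 , proj₂ (ℓ-parent source≢root)) target-below-ℓ

    ℓ-parent≢source : ℓ (p u) ≢ u
    ℓ-parent≢source ℓ≡u = source-not-last-born (p u , (u , source≢root , refl) , ℓ≡u)

    target-not-below-source : ¬ Anc p u v
    target-not-below-source u↑v with anc-comparable u↑v target-below-ℓ
    ... | inj₁ u↑ℓ = ℓ-parent≢source (sym (anc-depth-≡⇒≡ u↑ℓ (sym (depth-ℓ-parent source≢root))))
    ... | inj₂ ℓ↑u = ℓ-parent≢source (anc-depth-≡⇒≡ ℓ↑u (depth-ℓ-parent source≢root))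

    target-not-above-parent : ¬ Anc p v (p u)
    target-not-above-parent v↑pu = n≮n (depth (p u)) (begin-strict
      depth (p u)               <⟨ n<1+n (depth (p u)) ⟩
      suc (depth (p u))         ≡⟨ sym (depth-parent u source≢root) ⟩
      depth u                   ≡⟨ sym (depth-ℓ-parent source≢root) ⟩
      depth (ℓ (p u))           ≤⟨ anc⇒depth-≤ (anc-trans target-below-ℓ v↑pu) ⟩
      depth (p u)               ∎)
      where open ≤-Reasoning

    depth-≤ : depth u ≤ depth v
    depth-≤ = ≤-trans (≤-reflexive (sym (depth-ℓ-parent source≢root))) (anc⇒depth-≤ target-below-ℓ)

    depth-≡⇒target-last-born : depth u ≡ depth v → LastBorn v
    depth-≡⇒target-last-born du≡dv =
      p u , (u , source≢root , refl) ,
      anc-depth-≡⇒≡ target-below-ℓ (trans (depth-ℓ-parent source≢root) du≡dv)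

two-distinct-members : ∀ {A : Set} {xs : List A} → Unique xs → 2 ≤ length xs
                     → ∃₂ λ a b → a ≢ b × a ∈ xs × b ∈ xs
two-distinct-members {xs = []}    _ ()
two-distinct-members {xs = _ ∷ []} _ (s≤s ())
two-distinct-members {xs = a ∷ b ∷ _} ((a≢b ∷ _) ∷ _) _ = a , b , a≢b , here refl , there (here refl)

two-distinct-satisfying : ∀ {n} (f : Fin n → Bool) → 2 ≤ length (filterᵇ f (allFin n))
                        → ∃₂ λ a b → a ≢ b × f a ≡ true × f b ≡ true
two-distinct-satisfying {n} f two
  with a , b , a≢b , a∈ , b∈ ← two-distinct-members (filter⁺ (T? ∘ f) (allFin⁺ n)) two =
  a , b , a≢b , satisfies a∈ , satisfies b∈
  where
  satisfies : ∀ {x} → x ∈ filterᵇ f (allFin n) → f x ≡ true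
  satisfies x∈ = Equivalence.to T-≡ (proj₂ (∈-filter⁻ (T? ∘ f) {xs = allFin n} x∈))

module InducedGraph {n : ℕ} (B : BurlingTree n) (X : Fin n → Bool) where
  open BurlingTree B
  open Ancestry p
  open RootedTree B
  open BurlingArcs B

  TopAnc : Fin n → Fin n → Set
  TopAnc t v = Top B X t × Anc p t v

  top-anc-self : ∀ {t} → Top B X t → TopAnc t t
  top-anc-self tt = tt , anc-refl _

  top-anc-unique : ∀ {t t' v} → TopAnc t v → TopAnc t' v → t ≡ t'
  top-anc-unique (tt , t↑v) (tt' , t'↑v) with anc-comparable t↑v t'↑v
  ... | inj₁ t↑t' = proj₂ tt' _ (proj₁ tt) t↑t'
  ... | inj₂ t'↑t = sym (proj₂ tt _ (proj₁ tt') t'↑t)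

  NothingAbove : Fin n → Set
  NothingAbove v = ∀ w → InG B X w → ¬ Anc p w v

  sole-candidate⇒top-anc-or-nothing-above : ∀ {v} → (∀ w → InG B X w → Anc p w v → w ≡ v)
    → (∃ λ t → TopAnc t v) ⊎ NothingAbove v
  sole-candidate⇒top-anc-or-nothing-above {v} onlyItself with X v in xv
  ... | true  = inj₁ (v , (xv , onlyItself) , anc-refl v)
  ... | false = inj₂ λ w xw w↑v →
                  contradiction (trans (sym xw) (trans (cong X (onlyItself w xw w↑v)) xv)) λ ()

  top-anc-or-nothing-above : ∀ d v → depth v ≡ d → (∃ λ t → TopAnc t v) ⊎ NothingAbove v
  top-anc-or-nothing-above d v dv with v ≟ᶠ r
  ... | yes refl = sole-candidate⇒top-anc-or-nothing-above λ _ _ → anc-root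
  top-anc-or-nothing-above zero v dv | no v≢r with () ← trans (sym (depth-parent v v≢r)) dv
  top-anc-or-nothing-above (suc d) v dv | no v≢r
    with top-anc-or-nothing-above d (p v) (suc-injective (trans (sym (depth-parent v v≢r)) dv))
  ... | inj₁ (t , tt , t↑pv) = inj₁ (t , tt , anc-trans t↑pv (anc-parent v))
  ... | inj₂ nothing = sole-candidate⇒top-anc-or-nothing-above λ w xw w↑v →
          [ id , ⊥-elim ∘ nothing w xw ]′ (anc-cases w↑v)

  top-anc : ∀ {v} → InG B X v → ∃ λ t → TopAnc t v
  top-anc {v} xv with top-anc-or-nothing-above (depth v) v refl
  ... | inj₁ found   = found
  ... | inj₂ nothing = ⊥-elim (nothing v xv (anc-refl v))

  top? : ∀ v → Dec (Top B X v)
  top? v with X v ≟ᵇ true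
  ... | no  v∉G = no (v∉G ∘ proj₁)
  ... | yes v∈G with top-anc v∈G
  ...   | t , t↑v with t ≟ᶠ v
  ...     | yes refl = yes (proj₁ t↑v)
  ...     | no  t≢v  = no λ tv → t≢v (top-anc-unique t↑v (top-anc-self tv))

  arc? : ∀ u v → Dec (Arc B X u v)
  arc? u v = (X u ≟ᵇ true) ×-dec ((X v ≟ᵇ true) ×-dec (c u v ≟ᵇ true))

  no-loop : ∀ {x} → ¬ Arc B X x x
  no-loop (_ , _ , xx) = FullArc.target-not-below-source xx (anc-refl _)

  top-anc-along-arc : ∀ {t u v} → TopAnc t u → u ≢ t → Arc B X u v → TopAnc t v
  top-anc-along-arc (tt , t↑u) u≢t (_ , _ , uv) =
    tt , anc-trans (anc-strict t↑u (u≢t ∘ sym)) (FullArc.target-below-parent uv)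

  arc-to-top-anc : ∀ {x v t} → Top B X x → Arc B X x v → TopAnc t v → Arc B X x t
  arc-to-top-anc {x} {v} {t} tx (x∈G , _ , xv) (tt , t↑v)
    with anc-comparable t↑v (FullArc.target-below-ℓ xv)
  ... | inj₂ ℓ↑t = x∈G , proj₁ tt , FullArc.between xv ℓ↑t t↑v
  ... | inj₁ t↑ℓ with t ≟ᶠ ℓ (p x)
  ...   | yes refl = x∈G , proj₁ tt , FullArc.between xv (anc-refl t) t↑v
  ...   | no  t≢ℓ  = ⊥-elim (FullArc.target-not-below-source xv (subst (λ z → Anc p z v) t≡x t↑v))
    where
    t↑px : Anc p t (p x)
    t↑px = subst (Anc p t) (proj₂ (ℓ-parent (FullArc.source≢root xv))) (anc-strict t↑ℓ t≢ℓ)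
    t≡x : t ≡ x
    t≡x = proj₂ tx t (proj₁ tt) (anc-trans t↑px (anc-parent x))

  top-out-neighbour-unique : ∀ {x y z} → Arc B X x y → Arc B X x z → Top B X y → Top B X z → y ≡ z
  top-out-neighbour-unique (_ , _ , xy) (_ , _ , xz) ty tz with FullArc.targets-comparable xy xz
  ... | inj₁ y↑z = proj₂ tz _ (proj₁ ty) y↑z
  ... | inj₂ z↑y = sym (proj₂ ty _ (proj₁ tz) z↑y)

  walk-start : ∀ {P u v} → Walk B X P u v → P u
  walk-start (here pu)     = pu
  walk-start (step pu _ _) = pu

  walk-preserves : ∀ {P Q : Fin n → Set}
    → (∀ {u w} → P u → P w → Adj B X u w → Q u → Q w)
    → ∀ {u v} → Walk B X P u v → Q u → Q v
  walk-preserves step-preserves (here _)           qu = qu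
  walk-preserves step-preserves (step pu uw walk) qu =
    walk-preserves step-preserves walk (step-preserves pu (walk-start walk) uw qu)

  data TopPath (t : Fin n) : Fin n → Set where
    here : TopPath t t
    step : ∀ {x y} → Top B X y → Arc B X x y → TopPath t y → TopPath t x

  top-path-depth-≤ : ∀ {t x} → TopPath t x → depth x ≤ depth t
  top-path-depth-≤ here                      = ≤-refl
  top-path-depth-≤ (step _ (_ , _ , xy) path) = ≤-trans (FullArc.depth-≤ xy) (top-path-depth-≤ path)

  -- Arcs never decrease depth, and an arc between vertices of equal depth enters a last-born.
  arc-closes-no-top-path : ∀ {t s} → Arc B X t s → ¬ TopPath t s
  arc-closes-no-top-path ts here = no-loop ts
  arc-closes-no-top-path {t} {s} (_ , _ , ts) (step _ (_ , _ , sy) path) =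
    last-born-no-out-arc (FullArc.depth-≡⇒target-last-born ts dt≡ds) sy
    where
    dt≡ds : depth t ≡ depth s
    dt≡ds = ≤-antisym (FullArc.depth-≤ ts) (≤-trans (FullArc.depth-≤ sy) (top-path-depth-≤ path))

  SinkOfTop : Fin n → Set
  SinkOfTop s = Top B X s × (∀ y → Top B X y → ¬ Arc B X s y)

  adjᵇ⇒Adj : ∀ {u v} → adjᵇ B X u v ≡ true → Adj B X u v
  adjᵇ⇒Adj {u} {v} adj with X u | X v | c u v | c v u
  ... | true | true | true  | _    = inj₁ (refl , refl , refl)
  ... | true | true | false | true = inj₂ (refl , refl , refl)

module WithoutCutVertex {n : ℕ} (B : BurlingTree n) (X : Fin n → Bool) (nocut : NoCutVertex B X) where
  open BurlingTree B
  open Ancestry p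
  open BurlingArcs B
  open InducedGraph B X

  -- A walk from w ≢ t to s avoiding t carries ReachesTop from w to s, and a path from s to t
  -- closes a cycle with the arc t → s.
  module ArcInTop {t s : Fin n} (tt : Top B X t) (ts : Top B X s) (t→s : Arc B X t s) where

    ReachesTop : Fin n → Set
    ReachesTop w = ∃ λ x → TopAnc x w × TopPath t x

    reaches-along-edge : ∀ {w w'} → InG B X w × w ≢ t → InG B X w' × w' ≢ t
                       → Adj B X w w' → ReachesTop w → ReachesTop w'
    reaches-along-edge {w} {w'} (_ , w≢t) (w'∈G , _) adj (x , x↑w , path) with top-anc w'∈G | adj
    ... | x' , x'↑w' | inj₁ w→w' with w ≟ᶠ x
    ...   | no w≢x = x , top-anc-along-arc x↑w w≢x w→w' , path
    ...   | yes refl with path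
    ...     | here = ⊥-elim (w≢t refl)
    ...     | step ty w→y path' =
                x' , x'↑w' , subst (TopPath t) (top-out-neighbour-unique w→y w→x' ty (proj₁ x'↑w')) path'
      where w→x' : Arc B X w x'
            w→x' = arc-to-top-anc (proj₁ x↑w) w→w' x'↑w'
    reaches-along-edge {w} {w'} _ _ adj (x , x↑w , path) | x' , x'↑w' | inj₂ w'→w with w' ≟ᶠ x'
    ...   | no w'≢x' =
                x' , x'↑w' , subst (TopPath t) (top-anc-unique x↑w (top-anc-along-arc x'↑w' w'≢x' w'→w)) path
    ...   | yes refl = w' , x'↑w' , step (proj₁ x↑w) (arc-to-top-anc (proj₁ x'↑w') w'→w x↑w) path

    reaches⇒≡ : ∀ {w} → InG B X w → ReachesTop w → w ≡ t
    reaches⇒≡ {w} w∈G reaches with w ≟ᶠ t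
    ... | yes w≡t = w≡t
    ... | no  w≢t
      with walk-preserves reaches-along-edge (nocut t (proj₁ tt) w s (w∈G , w≢t) (proj₁ ts , s≢t)) reaches
      where s≢t : s ≢ t
            s≢t refl = no-loop t→s
    ...   | x , x↑s , path with top-anc-unique x↑s (top-anc-self ts)
    ...     | refl = ⊥-elim (arc-closes-no-top-path t→s path)

    only-descendant : ∀ {w} → InG B X w → TopAnc t w → w ≡ t
    only-descendant w∈G t↑w = reaches⇒≡ w∈G (t , t↑w , here)

    no-in-arc : ∀ {w} → ¬ Arc B X w t
    no-in-arc {w} w→t@(w∈G , _ , _) = no-loop (subst (λ z → Arc B X z t) (reaches⇒≡ w∈G reaches) w→t)
      where
      reaches : ReachesTop w
      reaches with top-anc w∈G
      ... | x , x↑w with w ≟ᶠ x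
      ...   | yes refl = w , x↑w , step tt w→t here
      ...   | no  w≢x  = x , x↑w , subst (TopPath t) t≡x here
        where t≡x : t ≡ x
              t≡x = sym (top-anc-unique (top-anc-along-arc x↑w w≢x w→t) (top-anc-self tt))

  sink-of-top : ∀ {t} → Top B X t → ∃ SinkOfTop
  sink-of-top {t} tt with any? (λ y → top? y ×-dec arc? t y)
  ... | no  none           = t , tt , λ y ty t→y → none (y , ty , t→y)
  ... | yes (y , ty , t→y) = y , ty , λ z tz y→z → ArcInTop.no-in-arc ty tz y→z t→y

  module AtSink {s : Fin n} (sink : SinkOfTop s) (conn : Connected B X) where

    ts : Top B X s
    ts = proj₁ sink

    BelowStar : Fin n → Set
    BelowStar w = ∃ λ x → TopAnc x w × (x ≡ s ⊎ Arc B X x s)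

    below-star-along-edge : ∀ {w w'} → InG B X w → InG B X w' → Adj B X w w' → BelowStar w → BelowStar w'
    below-star-along-edge {w} {w'} _ w'∈G adj (x , x↑w , x-in) with top-anc w'∈G | adj
    ... | x' , x'↑w' | inj₁ w→w' with w ≟ᶠ x
    ...   | no w≢x = x , top-anc-along-arc x↑w w≢x w→w' , x-in
    ...   | yes refl with x-in | arc-to-top-anc (proj₁ x↑w) w→w' x'↑w'
    ...     | inj₁ refl | w→x' = ⊥-elim (proj₂ sink x' (proj₁ x'↑w') w→x')
    ...     | inj₂ w→s  | w→x' =
                x' , x'↑w' , inj₁ (top-out-neighbour-unique w→x' w→s (proj₁ x'↑w') ts)
    below-star-along-edge {w} {w'} _ _ _ (x , x↑w , x-in) | x' , x'↑w' | inj₂ w'→w with w' ≟ᶠ x'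
    ...   | no w'≢x' = x' , x'↑w' ,
              subst (λ z → z ≡ s ⊎ Arc B X z s) (top-anc-unique x↑w (top-anc-along-arc x'↑w' w'≢x' w'→w)) x-in
    ...   | yes refl with x-in | arc-to-top-anc (proj₁ x'↑w') w'→w x↑w
    ...     | inj₁ refl | w'→s = w' , x'↑w' , inj₂ w'→s
    ...     | inj₂ x→s  | w'→x = ⊥-elim (ArcInTop.no-in-arc (proj₁ x↑w) ts x→s w'→x)

    below-star : ∀ {w} → InG B X w → BelowStar w
    below-star {w} w∈G =
      walk-preserves below-star-along-edge (proj₂ conn s w (proj₁ ts) w∈G) (s , top-anc-self ts , inj₁ refl)

    top-arc-to-sink : ∀ {u} → Top B X u → u ≢ s → Arc B X u s
    top-arc-to-sink tu u≢s with below-star (proj₁ tu)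
    ... | x , x↑u , x-in with top-anc-unique x↑u (top-anc-self tu)
    ...   | refl with x-in
    ...     | inj₁ u≡s = ⊥-elim (u≢s u≡s)
    ...     | inj₂ u→s = u→s

    top-source : ∀ u → Top B X u → u ≢ s → IsSourceOfG B X u
    top-source u tu u≢s w = ArcInTop.no-in-arc tu ts (top-arc-to-sink tu u≢s)

    nontop-below-sink : ∀ w → InG B X w → ¬ Top B X w → Anc p s w
    nontop-below-sink w w∈G ¬tw with below-star w∈G
    ... | x , x↑w , inj₁ refl = proj₂ x↑w
    ... | x , x↑w , inj₂ x→s  = ⊥-elim (¬tw (subst (Top B X) (sym w≡x) (proj₁ x↑w)))
      where w≡x : w ≡ x
            w≡x = ArcInTop.only-descendant (proj₁ x↑w) ts x→s w∈G x↑w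

    in-star : InStarWithSink B X s
    in-star = ts , λ u v tu tv → mk⇔ (to tu tv) (λ { (u≢s , refl) → tu , tv , top-arc-to-sink tu u≢s })
      where
      to : ∀ {u v} → Top B X u → Top B X v → ArcS B X u v → u ≢ s × v ≡ s
      to {u} {v} tu tv (_ , _ , u→v) = u≢s , top-out-neighbour-unique u→v (top-arc-to-sink tu u≢s) tv ts
        where u≢s : u ≢ s
              u≢s refl = proj₂ sink v tv u→v

    sink-neighbour-top : ∀ {u} → Adj B X u s → Top B X u
    sink-neighbour-top {u} adj with top? u
    ... | yes tu = tu
    ... | no ¬tu with adj
    ...   | inj₁ (u∈G , _ , us) = ⊥-elim (FullArc.target-not-above-parent us (anc-strict s↑u s≢u))
      where s≢u : s ≢ u
            s≢u refl = ¬tu ts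
            s↑u : Anc p s u
            s↑u = nontop-below-sink u u∈G ¬tu
    ...   | inj₂ (_ , u∈G , su) = ⊥-elim (FullArc.target-not-below-source su (nontop-below-sink u u∈G ¬tu))

    sink-neighbour-leaf : ∀ {u} → Adj B X u s → LeafS B X u
    sink-neighbour-leaf {u} adj =
      tu , (λ w (_ , _ , w→u) → top-source u tu u≢s w w→u) , s , (tu , ts , u→s) ,
      λ w (_ , tw , u→w) → top-out-neighbour-unique u→w u→s tw ts
      where
      tu : Top B X u
      tu = sink-neighbour-top adj
      u≢s : u ≢ s
      u≢s refl = [ no-loop , no-loop ]′ adj
      u→s : Arc B X u s
      u→s = top-arc-to-sink tu u≢s

    two-leaves : NoVertexOfDegreeAtMost1 B X → ∃₂ λ a b → a ≢ b × LeafS B X a × LeafS B X b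
    two-leaves deg≥2
      with a , b , a≢b , a~s , b~s ← two-distinct-satisfying (λ u → adjᵇ B X u s) (deg≥2 s (proj₁ ts)) =
      a , b , a≢b , sink-neighbour-leaf (adjᵇ⇒Adj a~s) , sink-neighbour-leaf (adjᵇ⇒Adj b~s)

lemma4p7 : ∀ {n} (B : BurlingTree n) (X : Fin n → Bool)
    → Connected B X → NoCutVertex B X → NoVertexOfDegreeAtMost1 B X
    → ∃ λ s → InStarWithSink B X s
        × (∃ λ a → ∃ λ b → a ≢ b × LeafS B X a × LeafS B X b)
        × (∀ u → Top B X u → u ≢ s → IsSourceOfG B X u)
        × (∀ w → InG B X w → ¬ Top B X w → Anc (BurlingTree.p B) s w)
lemma4p7 B X conn nocut deg≥2
  with (_ , v∈G) ← proj₁ conn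
  with (_ , tt , _) ← InducedGraph.top-anc B X v∈G
  with (s , sink) ← WithoutCutVertex.sink-of-top B X nocut tt =
  s , in-star , two-leaves deg≥2 , top-source , nontop-below-sink
  where open WithoutCutVertex.AtSink B X nocut sink conn
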